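{- Let $G$ be a finite Abelian group, $d\ge 3$, and $L=(L_{11},\dots,L_{1d})\in\mathbb{Z}^{1\times d}$. If at least three coefficients of $L$ are coprime to $|G|$, then \[ |\mathcal{C}^\#(L)|\le\binom{d}{2}\frac{|\mathcal{C}(L)|}{|G|}. \]
   Context: $\mathcal{C}(L)=\{v\in G^d:\sum_{i=1}^d L_{1i}v_i=0\}$ and $\mathcal{C}^\#(L)=\{v\in\mathcal{C}(L):\exists\, i\ne j\in\{1,\dots,d\}\text{ with } v_i=v_j\}$. -}

module Defs where

open import Level using (Level; _⊔_) renaming (suc to lsuc)
open import Algebra.Bundles using (AbelianGroup)
open import Data.Nat using (ℕ; zero; suc)
open import Data.Integer using (ℤ; +_; -[1+_])
open import Data.Fin using (Fin; zero; suc)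
open import Data.Fin.Properties using (any?)
open import Data.List using (List; []; _∷_; concatMap; map; filter; length; allFin)
open import Data.Product using (Σ; ∃; _×_; _,_)
open import Relation.Nullary using (Dec; ¬_; _×-dec_; ¬?)
open import Relation.Binary using (Decidable)
open import Relation.Binary.PropositionalEquality using (_≡_)
open import Relation.Unary using (Pred)
import Data.Fin.Properties as FinP

-- A finite abelian group: an abelian group (with its setoid equality ≈),
-- decidable ≈, and an enumeration Fin order → Carrier that is a bijection
-- up to ≈.  |G| = order.
record FiniteAbelianGroup (c ℓ : Level) : Set (lsuc (c ⊔ ℓ)) where
  field
    abGroup   : AbelianGroup c ℓ
  open AbelianGroup abGroup public
  field
    _≟_       : Decidable _≈_
    order     : ℕ
    enum      : Fin order → Carrier
    enum-inj  : ∀ i j → enum i ≈ enum j → i ≡ j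
    enum-surj : ∀ x → ∃ λ i → enum i ≈ x

  _·ℕ_ : ℕ → Carrier → Carrier
  zero  ·ℕ x = ε
  suc k ·ℕ x = x ∙ (k ·ℕ x)

  _·_ : ℤ → Carrier → Carrier
  (+ k)      · x = k ·ℕ x
  (-[1+ k ]) · x = (suc k ·ℕ x) ⁻¹

  gsum : (d : ℕ) → (Fin d → Carrier) → Carrier
  gsum zero    f = ε
  gsum (suc d) f = f zero ∙ gsum d (λ i → f (suc i))

-- all functions Fin d → Fin n, as a list (this enumerates G^d via enum)
allTuples : (d n : ℕ) → List (Fin d → Fin n)
allTuples zero    n = (λ ()) ∷ []
allTuples (suc d) n =
  concatMap (λ t → map (λ a → λ { zero → a ; (suc i) → t i }) (allFin n)) (allTuples d n)

count : ∀ {p} (d n : ℕ) {P : Pred (Fin d → Fin n) p} → Relation.Unary.Decidable P → ℕ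
count d n P? = length (filter P? (allTuples d n))

module _ {c ℓ} (G : FiniteAbelianGroup c ℓ) where
  open FiniteAbelianGroup G

  toG : ∀ {d} → (Fin d → Fin order) → Fin d → Carrier
  toG t i = enum (t i)

  InC : ∀ {d} → (Fin d → ℤ) → Pred (Fin d → Fin order) ℓ
  InC {d} L t = gsum d (λ i → L i · toG t i) ≈ ε

  InC? : ∀ {d} (L : Fin d → ℤ) → Relation.Unary.Decidable (InC L)
  InC? {d} L t = gsum d (λ i → L i · toG t i) ≟ ε

  HasRepeat : ∀ {d} → Pred (Fin d → Fin order) ℓ
  HasRepeat {d} t = ∃ λ i → ∃ λ j → ¬ (i ≡ j) × toG t i ≈ toG t j

  HasRepeat? : ∀ {d} → Relation.Unary.Decidable (HasRepeat {d})
  HasRepeat? t = any? λ i → any? λ j → ¬? (i FinP.≟ j) ×-dec (toG t i ≟ toG t j)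
    where import Data.Fin.Properties as FinP

  InC# : ∀ {d} → (Fin d → ℤ) → Pred (Fin d → Fin order) ℓ
  InC# L t = InC L t × HasRepeat t

  InC#? : ∀ {d} (L : Fin d → ℤ) → Relation.Unary.Decidable (InC# L)
  InC#? L t = InC? L t ×-dec HasRepeat? t

  ∣C∣ : ∀ d → (Fin d → ℤ) → ℕ
  ∣C∣ d L = count d order (InC? L)

  ∣C#∣ : ∀ d → (Fin d → ℤ) → ℕ
  ∣C#∣ d L = count d order (InC#? L)

-- Every v ∈ C#(L) lies in C_ij(L) = {v ∈ C(L) : v_i = v_j} for some i < j.  Pick k ∉ {i, j}
-- with L_k coprime to |G|; then L_k is invertible on G, and (v, a) ↦ v + a e_i + b e_k with
-- L_k b = -(L_i a) maps G × C_ij(L) injectively into C(L): coordinate j is untouched, so a is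
-- read off coordinate i.  Hence |G| |C_ij(L)| ≤ |C(L)|, and summing over the (d choose 2) pairs
-- gives the bound.  Invertibility of L_k comes from Bézout and |G| x = 0, the latter because
-- translation by x permutes G and so fixes Σ_{g ∈ G} g.
module Submission where

open import Defs
open import Level using (Level; 0ℓ)
open import Data.Nat using (ℕ; zero; suc; _+_; _*_; _≤_; z<s; s<s)
open import Data.Nat.Properties
  using (*-comm; *-zeroʳ; *-distribˡ-+; +-mono-≤; *-monoʳ-≤; ≤-reflexive; module ≤-Reasoning)
open import Data.Nat.Combinatorics using (_C_; nC1≡n; nCk+nC[k+1]≡[n+1]C[k+1])
open import Data.Nat.Coprimality using (Coprime; coprime-Bézout)
open import Data.Nat.GCD using (module Bézout)
open import Data.Integer using (ℤ; +_; -[1+_]; ∣_∣)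
open import Data.Fin using (Fin; zero; suc; _<_)
import Data.Fin.Properties as Fin
open import Data.Fin.Permutation using (permutation)
open import Data.List using (List; []; _∷_; _++_; map; filter; length; lookup; concatMap;
  cartesianProductWith; cartesianProduct; allFin)
open import Data.List.Properties using (length-++; length-map; length-tabulate)
open import Data.List.Relation.Unary.All as All using (All; [])
import Data.List.Relation.Unary.All.Properties as All
import Data.List.Relation.Unary.AllPairs as AllPairs
open import Data.List.Relation.Unary.Any as Any using (here; there)
import Data.List.Relation.Unary.Any.Properties as Any
open import Data.List.Relation.Unary.Unique.Setoid using (Unique)
open import Data.List.Relation.Unary.Unique.Setoid.Properties
  using (cartesianProductWith⁺; cartesianProduct⁺; filter⁺)
open import Data.List.Relation.Unary.Unique.Propositional.Properties using (allFin⁺)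
import Data.List.Membership.Setoid as SetoidMembership
open import Data.List.Membership.Setoid.Properties
  using (∈-lookup; index-injective; ∈-resp-≈; ∈-cartesianProductWith⁺; ∈-cartesianProduct⁻;
         ∈-filter⁺; ∈-filter⁻; ∈-concat⁺)
open import Data.List.Membership.Propositional using (_∈_)
import Data.List.Membership.Propositional.Properties as ∈
open import Data.Product using (∃; _×_; _,_; proj₁; proj₂; uncurry)
import Data.Product as Product
open import Data.Product.Relation.Binary.Pointwise.NonDependent using (_×ₛ_)
open import Data.Sum using (_⊎_; inj₁; inj₂; [_,_])
open import Function using (_∘_; id)
open import Relation.Binary using (Setoid; DecidableEquality; _Respects_; tri<; tri≈; tri>)
open import Relation.Binary.PropositionalEquality as ≡
  using (_≡_; _≢_; _≗_; refl; cong; cong₂; _→-setoid_; ≢-sym)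
open import Relation.Nullary using (¬_; yes; no; contradiction; _⊎-dec_; _×-dec_)
open import Relation.Unary using (Pred; Decidable)

module _ {a ℓ} (S : Setoid a ℓ) where
  open Setoid S using (_≈_; sym)

  lookup-injective : ∀ {xs} → Unique S xs → ∀ i j → lookup xs i ≈ lookup xs j → i ≡ j
  lookup-injective (_ AllPairs.∷ _) zero zero _ = refl
  lookup-injective (x≉xs AllPairs.∷ _) zero (suc j) x≈xⱼ =
    contradiction x≈xⱼ (All.lookup x≉xs (∈.∈-lookup j))
  lookup-injective (x≉xs AllPairs.∷ _) (suc i) zero xᵢ≈x =
    contradiction (sym xᵢ≈x) (All.lookup x≉xs (∈.∈-lookup i))
  lookup-injective (_ AllPairs.∷ xs!) (suc i) (suc j) xᵢ≈xⱼ =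
    cong suc (lookup-injective xs! i j xᵢ≈xⱼ)

module _ {a b ℓ₁ ℓ₂} (S : Setoid a ℓ₁) (T : Setoid b ℓ₂) where
  open Setoid S using () renaming (Carrier to A; _≈_ to _≈ₛ_)
  open Setoid T using () renaming (Carrier to B; _≈_ to _≈ₜ_)
  open SetoidMembership S using () renaming (_∈_ to _∈ₛ_)
  open SetoidMembership T using () renaming (_∈_ to _∈ₜ_)

  injection⇒length≤ : ∀ (f : A → B) {xs ys} → Unique S xs →
    (∀ {x} → x ∈ₛ xs → f x ∈ₜ ys) →
    (∀ {x y} → x ∈ₛ xs → y ∈ₛ xs → f x ≈ₜ f y → x ≈ₛ y) →
    length xs ≤ length ys
  injection⇒length≤ f {xs} {ys} xs! into f-injective = Fin.injective⇒≤ position-injective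
    where
    position : Fin (length xs) → Fin (length ys)
    position i = Any.index (into (∈-lookup S xs i))

    position-injective : ∀ {i j} → position i ≡ position j → i ≡ j
    position-injective {i} {j} eq = lookup-injective S xs! i j
      (f-injective (∈-lookup S xs i) (∈-lookup S xs j) (index-injective T _ _ eq))

length-cartesianProductWith : ∀ {a b c} {A : Set a} {B : Set b} {C : Set c}
  (f : A → B → C) xs ys → length (cartesianProductWith f xs ys) ≡ length xs * length ys
length-cartesianProductWith f []       ys = refl
length-cartesianProductWith f (x ∷ xs) ys = begin
  length (map (f x) ys ++ cartesianProductWith f xs ys)
    ≡⟨ length-++ (map (f x) ys) ⟩
  length (map (f x) ys) + length (cartesianProductWith f xs ys)
    ≡⟨ cong₂ _+_ (length-map (f x) ys) (length-cartesianProductWith f xs ys) ⟩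
  length ys + length xs * length ys ∎
  where open ≡.≡-Reasoning

concatMap-map≡cartesianProductWith : ∀ {a b c} {A : Set a} {B : Set b} {C : Set c}
  (f : A → B → C) xs ys → concatMap (λ x → map (f x) ys) xs ≡ cartesianProductWith f xs ys
concatMap-map≡cartesianProductWith f []       ys = refl
concatMap-map≡cartesianProductWith f (x ∷ xs) ys =
  cong (map (f x) ys ++_) (concatMap-map≡cartesianProductWith f xs ys)

*-length-concatMap-≤ : ∀ {a b} {A : Set a} {B : Set b} m k (f : A → List B) xs →
  (∀ {x} → x ∈ xs → m * length (f x) ≤ k) → m * length (concatMap f xs) ≤ length xs * k
*-length-concatMap-≤ m k f []       _     = ≤-reflexive (*-zeroʳ m)
*-length-concatMap-≤ m k f (x ∷ xs) bound = begin
  m * length (f x ++ concatMap f xs)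
    ≡⟨ cong (m *_) (length-++ (f x)) ⟩
  m * (length (f x) + length (concatMap f xs))
    ≡⟨ *-distribˡ-+ m (length (f x)) _ ⟩
  m * length (f x) + m * length (concatMap f xs)
    ≤⟨ +-mono-≤ (bound (here refl)) (*-length-concatMap-≤ m k f xs (bound ∘ there)) ⟩
  k + length xs * k ∎
  where open ≤-Reasoning

module _ (n : ℕ) where
  private
    Tuples : ℕ → Setoid 0ℓ 0ℓ
    Tuples d = Fin d →-setoid Fin n

  allTuples-unique : ∀ d → Unique (Tuples d) (allTuples d n)
  allTuples-unique zero    = [] AllPairs.∷ AllPairs.[]
  allTuples-unique (suc d) =
    ≡.subst (Unique (Tuples (suc d)))
      (≡.sym (concatMap-map≡cartesianProductWith _ (allTuples d n) (allFin n)))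
      (cartesianProductWith⁺ (Tuples d) (≡.setoid (Fin n)) (Tuples (suc d))
        _ (λ t∷a≗s∷b → (t∷a≗s∷b ∘ suc) , t∷a≗s∷b zero) (allTuples-unique d) (allFin⁺ n))

  ∈-allTuples : ∀ d (t : Fin d → Fin n) → SetoidMembership._∈_ (Tuples d) t (allTuples d n)
  ∈-allTuples zero    t = here λ ()
  ∈-allTuples (suc d) t =
    ≡.subst (SetoidMembership._∈_ (Tuples (suc d)) t)
      (≡.sym (concatMap-map≡cartesianProductWith _ (allTuples d n) (allFin n)))
      (∈-resp-≈ (Tuples (suc d)) (λ { zero → refl ; (suc i) → refl })
        (∈-cartesianProductWith⁺ (Tuples d) (≡.setoid (Fin n)) (Tuples (suc d))
          (λ { t≗s refl zero → refl ; t≗s refl (suc i) → t≗s i })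
          (∈-allTuples d (t ∘ suc)) (∈.∈-allFin (t zero))))

increasingPairs : ∀ d → List (Fin d × Fin d)
increasingPairs zero    = []
increasingPairs (suc d) =
  map (λ j → zero , suc j) (allFin d) ++ map (Product.map suc suc) (increasingPairs d)

length-increasingPairs : ∀ d → length (increasingPairs d) ≡ d C 2
length-increasingPairs zero    = refl
length-increasingPairs (suc d) = begin
  length (map (λ j → zero , suc j) (allFin d) ++ map (Product.map suc suc) (increasingPairs d))
    ≡⟨ length-++ (map (λ j → zero , suc j) (allFin d)) ⟩
  length (map (λ j → zero , suc j) (allFin d)) + length (map (Product.map suc suc) (increasingPairs d))
    ≡⟨ cong₂ _+_ (≡.trans (length-map _ (allFin d)) (length-tabulate id))
                 (≡.trans (length-map _ (increasingPairs d)) (length-increasingPairs d)) ⟩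
  d + d C 2
    ≡⟨ cong (_+ d C 2) (nC1≡n d) ⟨
  d C 1 + d C 2
    ≡⟨ nCk+nC[k+1]≡[n+1]C[k+1] d 1 ⟩
  suc d C 2 ∎
  where open ≡.≡-Reasoning

increasingPairs-< : ∀ d → All (uncurry _<_) (increasingPairs d)
increasingPairs-< zero    = []
increasingPairs-< (suc d) = All.++⁺ (All.map⁺ (All.universal (λ _ → z<s) (allFin d)))
                                    (All.map⁺ (All.map s<s (increasingPairs-< d)))

∈-increasingPairs : ∀ {d} {i j : Fin d} → i < j → (i , j) ∈ increasingPairs d
∈-increasingPairs {suc d} {zero}  {suc j} _         =
  ∈.∈-++⁺ˡ (∈.∈-map⁺ (λ j → zero , suc j) (∈.∈-allFin j))
∈-increasingPairs {suc d} {suc i} {suc j} (s<s i<j) =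
  ∈.∈-++⁺ʳ (map (λ j → zero , suc j) (allFin d))
           (∈.∈-map⁺ (Product.map suc suc) (∈-increasingPairs i<j))

module _ {a p} {A : Set a} (_≟_ : DecidableEquality A) (P : Pred A p) where

  private
    pair-exhausted : ∀ {x y z i j : A} → x ≢ y →
      x ≡ i ⊎ x ≡ j → y ≡ i ⊎ y ≡ j → z ≡ i ⊎ z ≡ j → z ≡ x ⊎ z ≡ y
    pair-exhausted x≢y (inj₁ refl) (inj₁ refl) _           = contradiction refl x≢y
    pair-exhausted x≢y (inj₁ refl) (inj₂ refl) (inj₁ refl) = inj₁ refl
    pair-exhausted x≢y (inj₁ refl) (inj₂ refl) (inj₂ refl) = inj₂ refl
    pair-exhausted x≢y (inj₂ refl) (inj₁ refl) (inj₁ refl) = inj₂ refl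
    pair-exhausted x≢y (inj₂ refl) (inj₁ refl) (inj₂ refl) = inj₁ refl
    pair-exhausted x≢y (inj₂ refl) (inj₂ refl) _           = contradiction refl x≢y

  avoid-two : ∀ {x y z} → x ≢ y → x ≢ z → y ≢ z → P x → P y → P z →
    ∀ i j → ∃ λ k → P k × k ≢ i × k ≢ j
  avoid-two {x} {y} {z} x≢y x≢z y≢z Px Py Pz i j
    with (x ≟ i) ⊎-dec (x ≟ j) | (y ≟ i) ⊎-dec (y ≟ j)
  ... | no x∉ij  | _         = x , Px , x∉ij ∘ inj₁ , x∉ij ∘ inj₂
  ... | yes _    | no y∉ij   = y , Py , y∉ij ∘ inj₁ , y∉ij ∘ inj₂
  ... | yes x∈ij | yes y∈ij = z , Pz , z∉ij ∘ inj₁ , z∉ij ∘ inj₂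
    where
    z∉ij : ¬ (z ≡ i ⊎ z ≡ j)
    z∉ij z∈ij = [ ≢-sym x≢z , ≢-sym y≢z ] (pair-exhausted x≢y x∈ij y∈ij z∈ij)

module FiniteAbelianGroupProperties {c ℓ} (G : FiniteAbelianGroup c ℓ) where
  open FiniteAbelianGroup G hiding (refl)
  open import Algebra.Properties.AbelianGroup abGroup
    using (identityˡ-unique; identityʳ-unique; inverseʳ-unique; ⁻¹-involutive; ⁻¹-∙-comm;
           ∙-cancelˡ; ∙-cancelʳ)
  open import Algebra.Properties.Monoid.Mult monoid using (×-congʳ; ×-assocˡ) renaming (_×_ to _×ᴳ_)
  open import Algebra.Properties.CommutativeMonoid.Mult commutativeMonoid using (×-distrib-+)
  open import Algebra.Properties.CommutativeMonoid.Sum commutativeMonoid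
    using (sum; sum-cong-≋; ∑-distrib-+; sum-permute; sum-replicate; sum-replicate-zero)
  open import Relation.Binary.Reasoning.Setoid setoid

  ·ℕ≡× : ∀ k x → k ·ℕ x ≡ k ×ᴳ x
  ·ℕ≡× zero    x = ≡.refl
  ·ℕ≡× (suc k) x = cong (x ∙_) (·ℕ≡× k x)

  gsum≡sum : ∀ d (f : Fin d → Carrier) → gsum d f ≡ sum f
  gsum≡sum zero    f = ≡.refl
  gsum≡sum (suc d) f = cong (f zero ∙_) (gsum≡sum d (f ∘ suc))

  ·ℕ-cong : ∀ k {x y} → x ≈ y → k ·ℕ x ≈ k ·ℕ y
  ·ℕ-cong k {x} {y} x≈y = begin
    k ·ℕ x  ≡⟨ ·ℕ≡× k x ⟩
    k ×ᴳ x  ≈⟨ ×-congʳ k x≈y ⟩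
    k ×ᴳ y  ≡⟨ ·ℕ≡× k y ⟨
    k ·ℕ y  ∎

  ·ℕ-distrib-∙ : ∀ k x y → k ·ℕ (x ∙ y) ≈ k ·ℕ x ∙ k ·ℕ y
  ·ℕ-distrib-∙ k x y = begin
    k ·ℕ (x ∙ y)       ≡⟨ ·ℕ≡× k (x ∙ y) ⟩
    k ×ᴳ (x ∙ y)       ≈⟨ ×-distrib-+ x y k ⟩
    k ×ᴳ x ∙ k ×ᴳ y    ≡⟨ cong₂ _∙_ (·ℕ≡× k x) (·ℕ≡× k y) ⟨
    k ·ℕ x ∙ k ·ℕ y    ∎

  ·ℕ-assoc : ∀ m k x → m ·ℕ (k ·ℕ x) ≈ (m * k) ·ℕ x
  ·ℕ-assoc m k x = begin
    m ·ℕ (k ·ℕ x)   ≡⟨ ≡.trans (·ℕ≡× m (k ·ℕ x)) (cong (m ×ᴳ_) (·ℕ≡× k x)) ⟩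
    m ×ᴳ (k ×ᴳ x)   ≈⟨ ×-assocˡ x m k ⟩
    (m * k) ×ᴳ x    ≡⟨ ·ℕ≡× (m * k) x ⟨
    (m * k) ·ℕ x    ∎

  ·-cong : ∀ L {x y} → x ≈ y → L · x ≈ L · y
  ·-cong (+ k)      = ·ℕ-cong k
  ·-cong (-[1+ k ]) = ⁻¹-cong ∘ ·ℕ-cong (suc k)

  ·-distrib-∙ : ∀ L x y → L · (x ∙ y) ≈ L · x ∙ L · y
  ·-distrib-∙ (+ k)      x y = ·ℕ-distrib-∙ k x y
  ·-distrib-∙ (-[1+ k ]) x y =
    trans (⁻¹-cong (·ℕ-distrib-∙ (suc k) x y)) (sym (⁻¹-∙-comm _ _))

  ·-ε : ∀ L → L · ε ≈ ε
  ·-ε L = identityʳ-unique (L · ε) (L · ε)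
    (sym (trans (·-cong L (sym (identityʳ ε))) (·-distrib-∙ L ε ε)))

  enum⁻¹ : Carrier → Fin order
  enum⁻¹ x = proj₁ (enum-surj x)

  enum-enum⁻¹ : ∀ x → enum (enum⁻¹ x) ≈ x
  enum-enum⁻¹ x = proj₂ (enum-surj x)

  translate : Carrier → Fin order → Fin order
  translate x i = enum⁻¹ (x ∙ enum i)

  translate-inverse : ∀ {x y} → x ∙ y ≈ ε → ∀ i → translate x (translate y i) ≡ i
  translate-inverse {x} {y} x∙y≈ε i = enum-inj _ _ (begin
    enum (translate x (translate y i))  ≈⟨ enum-enum⁻¹ _ ⟩
    x ∙ enum (translate y i)            ≈⟨ ∙-congˡ (enum-enum⁻¹ _) ⟩
    x ∙ (y ∙ enum i)                    ≈⟨ assoc x y _ ⟨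
    (x ∙ y) ∙ enum i                    ≈⟨ ∙-congʳ x∙y≈ε ⟩
    ε ∙ enum i                          ≈⟨ identityˡ _ ⟩
    enum i                              ∎)

  order-annihilates : ∀ x → order ·ℕ x ≈ ε
  order-annihilates x = identityˡ-unique (order ·ℕ x) (sum enum) (begin
    order ·ℕ x ∙ sum enum               ≡⟨ cong (_∙ sum enum) (·ℕ≡× order x) ⟩
    order ×ᴳ x ∙ sum enum               ≈⟨ ∙-congʳ (sum-replicate order) ⟨
    sum {order} (λ _ → x) ∙ sum enum    ≈⟨ ∑-distrib-+ (λ _ → x) enum ⟨
    sum {order} (λ i → x ∙ enum i)      ≈⟨ sum-cong-≋ (λ i → enum-enum⁻¹ (x ∙ enum i)) ⟨
    sum {order} (enum ∘ translate x)    ≈⟨ sum-permute enum π ⟨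
    sum enum                            ∎)
    where
    π = permutation (translate x) (translate (x ⁻¹))
          (translate-inverse (inverseʳ x)) (translate-inverse (inverseˡ x))

  multiple-of-order-annihilates : ∀ m x → (m * order) ·ℕ x ≈ ε
  multiple-of-order-annihilates m x = begin
    (m * order) ·ℕ x   ≈⟨ ·ℕ-assoc m order x ⟨
    m ·ℕ (order ·ℕ x)  ≈⟨ ·ℕ-cong m (order-annihilates x) ⟩
    m ·ℕ ε             ≈⟨ ·-ε (+ m) ⟩
    ε                  ∎

  ·ℕ-surjective : ∀ {m} → Coprime m order → ∀ z → ∃ λ w → m ·ℕ w ≈ z
  ·ℕ-surjective {m} m⊥order z with coprime-Bézout m⊥order
  ... | Bézout.+- x y 1+y*order≡x*m = x ·ℕ z , (begin
    m ·ℕ (x ·ℕ z)           ≈⟨ ·ℕ-assoc m x z ⟩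
    (m * x) ·ℕ z            ≡⟨ cong (_·ℕ z) (≡.trans (*-comm m x) (≡.sym 1+y*order≡x*m)) ⟩
    z ∙ (y * order) ·ℕ z    ≈⟨ ∙-congˡ (multiple-of-order-annihilates y z) ⟩
    z ∙ ε                   ≈⟨ identityʳ z ⟩
    z                       ∎)
  ... | Bézout.-+ x y 1+x*m≡y*order = x ·ℕ (z ⁻¹) ,
    trans (inverseʳ-unique (z ⁻¹) _ (begin
      z ⁻¹ ∙ m ·ℕ (x ·ℕ (z ⁻¹))   ≈⟨ ∙-congˡ (·ℕ-assoc m x (z ⁻¹)) ⟩
      z ⁻¹ ∙ (m * x) ·ℕ (z ⁻¹)    ≡⟨ cong (λ k → z ⁻¹ ∙ k ·ℕ (z ⁻¹)) (*-comm m x) ⟩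
      suc (x * m) ·ℕ (z ⁻¹)       ≡⟨ cong (_·ℕ (z ⁻¹)) 1+x*m≡y*order ⟩
      (y * order) ·ℕ (z ⁻¹)       ≈⟨ multiple-of-order-annihilates y (z ⁻¹) ⟩
      ε                           ∎))
    (⁻¹-involutive z)

  ·-surjective : ∀ L → Coprime ∣ L ∣ order → ∀ z → ∃ λ w → L · w ≈ z
  ·-surjective (+ k)      k⊥order = ·ℕ-surjective k⊥order
  ·-surjective (-[1+ k ]) k⊥order z with ·ℕ-surjective k⊥order (z ⁻¹)
  ... | w , k·w≈z⁻¹ = w , trans (⁻¹-cong k·w≈z⁻¹) (⁻¹-involutive z)

  form : ∀ {d} → (Fin d → ℤ) → (Fin d → Carrier) → Carrier
  form {d} L v = gsum d (λ i → L i · v i)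

  form-cong : ∀ {d} (L : Fin d → ℤ) {u v} → (∀ i → u i ≈ v i) → form L u ≈ form L v
  form-cong {d} L {u} {v} u≈v = begin
    form L u               ≡⟨ gsum≡sum d _ ⟩
    sum (λ i → L i · u i)  ≈⟨ sum-cong-≋ (λ i → ·-cong (L i) (u≈v i)) ⟩
    sum (λ i → L i · v i)  ≡⟨ gsum≡sum d _ ⟨
    form L v               ∎

  form-∙ : ∀ {d} (L : Fin d → ℤ) u v → form L (λ i → u i ∙ v i) ≈ form L u ∙ form L v
  form-∙ {d} L u v = begin
    form L (λ i → u i ∙ v i)
      ≡⟨ gsum≡sum d _ ⟩
    sum (λ i → L i · (u i ∙ v i))
      ≈⟨ sum-cong-≋ (λ i → ·-distrib-∙ (L i) (u i) (v i)) ⟩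
    sum (λ i → L i · u i ∙ L i · v i)
      ≈⟨ ∑-distrib-+ (λ i → L i · u i) (λ i → L i · v i) ⟩
    sum (λ i → L i · u i) ∙ sum (λ i → L i · v i)
      ≡⟨ cong₂ _∙_ (gsum≡sum d _) (gsum≡sum d _) ⟨
    form L u ∙ form L v ∎

  form-ε : ∀ {d} (L : Fin d → ℤ) → form L (λ _ → ε) ≈ ε
  form-ε {d} L = begin
    form L (λ _ → ε)       ≡⟨ gsum≡sum d _ ⟩
    sum (λ i → L i · ε)    ≈⟨ sum-cong-≋ (λ i → ·-ε (L i)) ⟩
    sum {d} (λ _ → ε)      ≈⟨ sum-replicate-zero d ⟩
    ε                      ∎

  single : ∀ {d} → Fin d → Carrier → Fin d → Carrier
  single zero    x zero    = x
  single zero    x (suc _) = ε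
  single (suc i) x zero    = ε
  single (suc i) x (suc l) = single i x l

  single-≡ : ∀ {d} (i : Fin d) x → single i x i ≡ x
  single-≡ zero    x = ≡.refl
  single-≡ (suc i) x = single-≡ i x

  single-≢ : ∀ {d} {i l : Fin d} x → l ≢ i → single i x l ≡ ε
  single-≢ {i = zero}  {zero}  x l≢i = contradiction ≡.refl l≢i
  single-≢ {i = zero}  {suc l} x l≢i = ≡.refl
  single-≢ {i = suc i} {zero}  x l≢i = ≡.refl
  single-≢ {i = suc i} {suc l} x l≢i = single-≢ x (l≢i ∘ cong suc)

  form-single : ∀ {d} (L : Fin d → ℤ) i x → form L (single i x) ≈ L i · x
  form-single L zero    x = begin
    L zero · x ∙ form (L ∘ suc) (λ _ → ε)        ≈⟨ ∙-congˡ (form-ε (L ∘ suc)) ⟩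
    L zero · x ∙ ε                               ≈⟨ identityʳ _ ⟩
    L zero · x                                   ∎
  form-single L (suc i) x = begin
    L zero · ε ∙ form (L ∘ suc) (single i x)     ≈⟨ ∙-congʳ (·-ε (L zero)) ⟩
    ε ∙ form (L ∘ suc) (single i x)              ≈⟨ identityˡ _ ⟩
    form (L ∘ suc) (single i x)                  ≈⟨ form-single (L ∘ suc) i x ⟩
    L (suc i) · x                                ∎

  module Shift {d} (L : Fin d → ℤ) {i j k : Fin d} (i≢j : i ≢ j) (k≢i : k ≢ i) (k≢j : k ≢ j)
               (Lk⊥order : Coprime ∣ L k ∣ order) where

    compensator : Carrier → Carrier
    compensator a = proj₁ (·-surjective (L k) Lk⊥order ((L i · a) ⁻¹))

    displacement : Carrier → Fin d → Carrier
    displacement a l = single i a l ∙ single k (compensator a) l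

    shift : Carrier → (Fin d → Carrier) → Fin d → Carrier
    shift a v l = v l ∙ displacement a l

    form-displacement : ∀ a → form L (displacement a) ≈ ε
    form-displacement a = begin
      form L (displacement a)
        ≈⟨ form-∙ L _ _ ⟩
      form L (single i a) ∙ form L (single k (compensator a))
        ≈⟨ ∙-cong (form-single L i a) (form-single L k _) ⟩
      L i · a ∙ L k · compensator a
        ≈⟨ ∙-congˡ (proj₂ (·-surjective (L k) Lk⊥order _)) ⟩
      L i · a ∙ (L i · a) ⁻¹
        ≈⟨ inverseʳ _ ⟩
      ε ∎

    form-shift : ∀ a v → form L (shift a v) ≈ form L v
    form-shift a v = begin
      form L (shift a v)                     ≈⟨ form-∙ L v (displacement a) ⟩
      form L v ∙ form L (displacement a)     ≈⟨ ∙-congˡ (form-displacement a) ⟩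
      form L v ∙ ε                           ≈⟨ identityʳ _ ⟩
      form L v                               ∎

    shift-at-i : ∀ a v → shift a v i ≈ v i ∙ a
    shift-at-i a v = begin
      v i ∙ (single i a i ∙ single k (compensator a) i)
        ≡⟨ cong₂ (λ x y → v i ∙ (x ∙ y)) (single-≡ i a) (single-≢ _ (≢-sym k≢i)) ⟩
      v i ∙ (a ∙ ε)
        ≈⟨ ∙-congˡ (identityʳ a) ⟩
      v i ∙ a ∎

    shift-at-j : ∀ a v → shift a v j ≈ v j
    shift-at-j a v = begin
      v j ∙ (single i a j ∙ single k (compensator a) j)
        ≡⟨ cong₂ (λ x y → v j ∙ (x ∙ y)) (single-≢ a (≢-sym i≢j)) (single-≢ _ (≢-sym k≢j)) ⟩
      v j ∙ (ε ∙ ε)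
        ≈⟨ ∙-congˡ (identityˡ ε) ⟩
      v j ∙ ε
        ≈⟨ identityʳ _ ⟩
      v j ∎

    shift-amount-injective : ∀ {a b u v} → u i ≈ u j → v i ≈ v j →
      (∀ l → shift a u l ≈ shift b v l) → a ≈ b
    shift-amount-injective {a} {b} {u} {v} uᵢ≈uⱼ vᵢ≈vⱼ shifts≈ = ∙-cancelˡ (u i) a b (begin
      u i ∙ a       ≈⟨ shift-at-i a u ⟨
      shift a u i   ≈⟨ shifts≈ i ⟩
      shift b v i   ≈⟨ shift-at-i b v ⟩
      v i ∙ b       ≈⟨ ∙-congʳ uᵢ≈vᵢ ⟨
      u i ∙ b       ∎)
      where
      uᵢ≈vᵢ : u i ≈ v i
      uᵢ≈vᵢ = begin
        u i          ≈⟨ uᵢ≈uⱼ ⟩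
        u j          ≈⟨ shift-at-j a u ⟨
        shift a u j  ≈⟨ shifts≈ j ⟩
        shift b v j  ≈⟨ shift-at-j b v ⟩
        v j          ≈⟨ vᵢ≈vⱼ ⟨
        v i          ∎

    shift-cancel : ∀ {a u v} → (∀ l → shift a u l ≈ shift a v l) → ∀ l → u l ≈ v l
    shift-cancel {a} shifts≈ l = ∙-cancelʳ (displacement a l) _ _ (shifts≈ l)

module Counting {c ℓ} (G : FiniteAbelianGroup c ℓ) {d : ℕ} (L : Fin d → ℤ) where
  open FiniteAbelianGroup G hiding (refl)
  open FiniteAbelianGroupProperties G

  Tuples : Setoid 0ℓ 0ℓ
  Tuples = Fin d →-setoid Fin order

  open SetoidMembership Tuples using () renaming (_∈_ to _∈ₜ_)

  tuples : List (Fin d → Fin order)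
  tuples = allTuples d order

  toG-cong : ∀ {s t : Fin d → Fin order} → s ≗ t → ∀ l → toG G s l ≈ toG G t l
  toG-cong s≗t l = reflexive (cong enum (s≗t l))

  InC-resp : InC G L Respects _≗_
  InC-resp s≗t s∈C = trans (sym (form-cong L (toG-cong s≗t))) s∈C

  InC#-resp : InC# G L Respects _≗_
  InC#-resp s≗t (s∈C , i , j , i≢j , sᵢ≈sⱼ) =
    InC-resp s≗t s∈C , i , j , i≢j ,
    trans (sym (toG-cong s≗t i)) (trans sᵢ≈sⱼ (toG-cong s≗t j))

  InCTied : Fin d × Fin d → Pred (Fin d → Fin order) ℓ
  InCTied (i , j) t = InC G L t × toG G t i ≈ toG G t j

  InCTied? : ∀ p → Decidable (InCTied p)
  InCTied? (i , j) t = InC? G L t ×-dec (toG G t i ≟ toG G t j)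

  InCTied-resp : ∀ p → InCTied p Respects _≗_
  InCTied-resp (i , j) s≗t (s∈C , sᵢ≈sⱼ) =
    InC-resp s≗t s∈C , trans (sym (toG-cong s≗t i)) (trans sᵢ≈sⱼ (toG-cong s≗t j))

  tied : Fin d × Fin d → List (Fin d → Fin order)
  tied p = filter (InCTied? p) tuples

  InC#⇒tied : ∀ {t} → InC# G L t → ∃ λ p → p ∈ increasingPairs d × InCTied p t
  InC#⇒tied (t∈C , i , j , i≢j , tᵢ≈tⱼ) with Fin.<-cmp i j
  ... | tri< i<j _ _ = (i , j) , ∈-increasingPairs i<j , t∈C , tᵢ≈tⱼ
  ... | tri≈ _ i≡j _ = contradiction i≡j i≢j
  ... | tri> _ _ j<i = (j , i) , ∈-increasingPairs j<i , t∈C , sym tᵢ≈tⱼ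

  C#⊆⋃tied : ∀ {t} → t ∈ₜ filter (InC#? G L) tuples →
    t ∈ₜ concatMap tied (increasingPairs d)
  C#⊆⋃tied t∈filter with ∈-filter⁻ Tuples (InC#? G L) InC#-resp {xs = tuples} t∈filter
  ... | t∈tuples , t∈C# with InC#⇒tied t∈C#
  ... | p , p∈pairs , tiedₚ = ∈-concat⁺ Tuples (Any.map⁺ (Any.map
    (λ { refl → ∈-filter⁺ Tuples (InCTied? p) (InCTied-resp p) t∈tuples tiedₚ }) p∈pairs))

  ∣C#∣≤∣⋃tied∣ : ∣C#∣ G d L ≤ length (concatMap tied (increasingPairs d))
  ∣C#∣≤∣⋃tied∣ = injection⇒length≤ Tuples Tuples id
    (filter⁺ Tuples (InC#? G L) (allTuples-unique order d)) C#⊆⋃tied (λ _ _ → id)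

  module _ {i j k : Fin d} (i≢j : i ≢ j) (k≢i : k ≢ i) (k≢j : k ≢ j)
           (Lk⊥order : Coprime ∣ L k ∣ order) where
    open Shift L i≢j k≢i k≢j Lk⊥order

    shiftTuple : (Fin d → Fin order) × Fin order → Fin d → Fin order
    shiftTuple (t , a) l = enum⁻¹ (shift (enum a) (toG G t) l)

    toG-shiftTuple : ∀ t a l → toG G (shiftTuple (t , a)) l ≈ shift (enum a) (toG G t) l
    toG-shiftTuple t a l = enum-enum⁻¹ _

    shiftTuple-InC : ∀ {t} a → InC G L t → InC G L (shiftTuple (t , a))
    shiftTuple-InC {t} a t∈C =
      trans (form-cong L (toG-shiftTuple t a)) (trans (form-shift (enum a) (toG G t)) t∈C)

    shiftTuple-≗ : ∀ {t a s b} → shiftTuple (t , a) ≗ shiftTuple (s , b) →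
      ∀ l → shift (enum a) (toG G t) l ≈ shift (enum b) (toG G s) l
    shiftTuple-≗ {t} {a} {s} {b} eq l =
      trans (sym (toG-shiftTuple t a l)) (trans (toG-cong eq l) (toG-shiftTuple s b l))

    shiftTuple-injective : ∀ {t a s b} → InCTied (i , j) t → InCTied (i , j) s →
      shiftTuple (t , a) ≗ shiftTuple (s , b) → t ≗ s × a ≡ b
    shiftTuple-injective {a = a} {b = b} (_ , tᵢ≈tⱼ) (_ , sᵢ≈sⱼ) eq
      with enum-inj a b (shift-amount-injective tᵢ≈tⱼ sᵢ≈sⱼ (shiftTuple-≗ eq))
    ... | refl = (λ l → enum-inj _ _ (shift-cancel (shiftTuple-≗ eq) l)) , refl

    order*∣tied∣≤∣C∣ : order * length (tied (i , j)) ≤ ∣C∣ G d L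
    order*∣tied∣≤∣C∣ = begin
      order * length (tied (i , j))
        ≡⟨ *-comm order _ ⟩
      length (tied (i , j)) * order
        ≡⟨ cong (length (tied (i , j)) *_) (length-tabulate id) ⟨
      length (tied (i , j)) * length (allFin order)
        ≡⟨ length-cartesianProductWith _,_ (tied (i , j)) (allFin order) ⟨
      length sources
        ≤⟨ injection⇒length≤ Pairs Tuples shiftTuple sources-unique into injective ⟩
      ∣C∣ G d L ∎
      where
      open ≤-Reasoning

      Pairs : Setoid 0ℓ 0ℓ
      Pairs = Tuples ×ₛ ≡.setoid (Fin order)

      open SetoidMembership Pairs using () renaming (_∈_ to _∈ₚ_)

      sources : List ((Fin d → Fin order) × Fin order)
      sources = cartesianProduct (tied (i , j)) (allFin order)

      sources-unique : Unique Pairs sources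
      sources-unique = cartesianProduct⁺ Tuples (≡.setoid (Fin order))
        (filter⁺ Tuples (InCTied? (i , j)) (allTuples-unique order d)) (allFin⁺ order)

      tied-of : ∀ {t a} → (t , a) ∈ₚ sources → InCTied (i , j) t
      tied-of ta∈ = proj₂ (∈-filter⁻ Tuples (InCTied? (i , j)) (InCTied-resp (i , j)) {xs = tuples}
        (proj₁ (∈-cartesianProduct⁻ Tuples (≡.setoid (Fin order)) (tied (i , j)) (allFin order) ta∈)))

      into : ∀ {ta} → ta ∈ₚ sources → shiftTuple ta ∈ₜ filter (InC? G L) tuples
      into {t , a} ta∈ = ∈-filter⁺ Tuples (InC? G L) InC-resp (∈-allTuples order d _)
        (shiftTuple-InC a (proj₁ (tied-of ta∈)))

      injective : ∀ {ta sb} → ta ∈ₚ sources → sb ∈ₚ sources →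
        shiftTuple ta ≗ shiftTuple sb → Setoid._≈_ Pairs ta sb
      injective {t , a} {s , b} ta∈ sb∈ = shiftTuple-injective (tied-of ta∈) (tied-of sb∈)

lemma3p2 : ∀ {c ℓ : Level} (G : FiniteAbelianGroup c ℓ) (d : ℕ) (L : Fin d → ℤ) →
    3 ≤ d →
    (∃ λ i → ∃ λ j → ∃ λ k → ¬ i ≡ j × ¬ i ≡ k × ¬ j ≡ k ×
      Coprime (∣ L i ∣) (FiniteAbelianGroup.order G) ×
      Coprime (∣ L j ∣) (FiniteAbelianGroup.order G) ×
      Coprime (∣ L k ∣) (FiniteAbelianGroup.order G)) →
    FiniteAbelianGroup.order G * ∣C#∣ G d L ≤ (d C 2) * ∣C∣ G d L
-- The hypothesis 3 ≤ d is implied by the three distinct indices.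
lemma3p2 G d L _ (a , b , c , a≢b , a≢c , b≢c , La⊥ , Lb⊥ , Lc⊥) = begin
  order * ∣C#∣ G d L
    ≤⟨ *-monoʳ-≤ order ∣C#∣≤∣⋃tied∣ ⟩
  order * length (concatMap tied (increasingPairs d))
    ≤⟨ *-length-concatMap-≤ order _ tied _ order*∣tied∣≤∣C∣ₚ ⟩
  length (increasingPairs d) * ∣C∣ G d L
    ≡⟨ cong (_* ∣C∣ G d L) (length-increasingPairs d) ⟩
  (d C 2) * ∣C∣ G d L ∎
  where
  open ≤-Reasoning
  open FiniteAbelianGroup G using (order)
  open Counting G L

  order*∣tied∣≤∣C∣ₚ : ∀ {p} → p ∈ increasingPairs d → order * length (tied p) ≤ ∣C∣ G d L
  order*∣tied∣≤∣C∣ₚ {i , j} p∈pairs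
    with avoid-two Fin._≟_ (λ k → Coprime ∣ L k ∣ order) a≢b a≢c b≢c La⊥ Lb⊥ Lc⊥ i j
  ... | k , Lk⊥order , k≢i , k≢j =
    order*∣tied∣≤∣C∣ (Fin.<⇒≢ (All.lookup (increasingPairs-< d) p∈pairs)) k≢i k≢j Lk⊥order
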